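{- If $v$ is a vertex of a simple graph $G$ and $e$ is any edge incident with $v$, then there is at least one choice of $H\in\{G-v,\ (G\times e)-v\}$ such that no tangle of $\mathrm{CR}(G)$ splits in $\mathrm{CR}(H)$; that is, for every positive integer $k$ and every tangle $\mathcal{T}$ of order $k$ in $\mathrm{CR}(G)$, there do not exist two distinct tangles of order $k$ in $\mathrm{CR}(H)$ that both induce $\mathcal{T}$.
   Context: For a simple graph $G$ with vertex set $V$ and adjacency matrix $A$, the cut-rank $\rho_G(X)$ of $X\subseteq V$ is the rank over $\mathrm{GF}(2)$ of $A[X,V\setminus X]$, and $\mathrm{CR}(G)=(V,\rho_G)$; this is a connectivity system, i.e. $\rho_G(X)=\rho_G(V\setminus X)$ and $\rho_G$ is submodular. For a vertex $w$, the local complement $G*w$ is obtained by replacing the subgraph induced on the neighbourhood of $w$ by its complement; for an edge $e=uw$, $G\times e=G*u*w*u$. For a connectivity system $K=(E,\lambda)$, $\mathcal S_k(K)$ is the set of $X\subseteq E$ with $\lambda(X)<k$; a tangle of order $k$ in $K$ is a set $\mathcal{T}\subseteq\mathcal S_k(K)$ such that for each $A\in\mathcal S_k(K)$ exactly one of $A$, $E\setminus A$ lies in $\mathcal{T}$, there are no $T_1,T_2,T_3\in\mathcal{T}$ with $T_1\cup T_2\cup T_3=E$, and no set in $\mathcal{T}$ has size $|E|-1$. If $H$ is an induced subgraph-type reduction with $V(H)\subseteq V(G)$ and $\mathcal{T}_0$ is a tangle of order $k$ in $\mathrm{CR}(H)$, the tangle of $\mathrm{CR}(G)$ induced by $\mathcal{T}_0$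 is $\{X\in\mathcal S_k(\mathrm{CR}(G)): X\cap V(H)\in\mathcal{T}_0\}$. A tangle $\mathcal{T}$ of order $k$ in $\mathrm{CR}(G)$ splits in $\mathrm{CR}(H)$ if two distinct tangles of order $k$ in $\mathrm{CR}(H)$ both induce $\mathcal{T}$. -}

module Defs where

open import Data.Nat using (ℕ; zero; suc; _<_)
open import Data.Fin using (Fin; zero; suc; punchIn; _≟_)
open import Data.Fin.Subset using (Subset; ∁; _∪_; ⊤; ∣_∣)
open import Data.Bool using (Bool; true; false; _∧_; not; _xor_)
open import Data.Vec using (lookup; tabulate)
open import Data.Product using (Σ; _×_; ∃)
open import Relation.Nullary using (¬_)
open import Relation.Nullary.Decidable using (⌊_⌋)
open import Relation.Binary.PropositionalEquality using (_≡_; _≢_)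
open import Function using (_∘_)

Adj : ℕ → Set
Adj n = Fin n → Fin n → Bool

IsSimple : ∀ {n} → Adj n → Set
IsSimple {n} A = (∀ (x y : Fin n) → A x y ≡ A y x) × (∀ (x : Fin n) → A x x ≡ false)

-- local complementation at w: complement the subgraph induced on N(w)
localComp : ∀ {n} → Adj n → Fin n → Adj n
localComp A w x y = A x y xor (A w x ∧ (A w y ∧ not ⌊ x ≟ y ⌋))

-- pivot on the edge e = uw:  G × e = G * u * w * u
pivot : ∀ {n} → Adj n → Fin n → Fin n → Adj n
pivot A u w = localComp (localComp (localComp A u) w) u

delete : ∀ {n} → Adj (suc n) → Fin (suc n) → Adj n
delete A v i j = A (punchIn v i) (punchIn v j)

-- X ∩ V(G - v), as a subset of the vertex set of G - v
restrict : ∀ {n} → Fin (suc n) → Subset (suc n) → Subset n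
restrict v X = tabulate (λ i → lookup X (punchIn v i))

dot : ∀ r → (Fin r → Bool) → (Fin r → Bool) → Bool
dot zero a b = false
dot (suc r) a b = (a zero ∧ b zero) xor dot r (a ∘ suc) (b ∘ suc)

RankLe : ∀ {m p} → (Fin m → Fin p → Bool) → ℕ → Set
RankLe {m} {p} M r =
  Σ (Fin m → Fin r → Bool) λ B → Σ (Fin r → Fin p → Bool) λ C →
    ∀ i j → M i j ≡ dot r (B i) (λ t → C t j)

-- A[X, V∖X], padded with zero rows/columns outside X × (V∖X) (does not change rank)
cutMatrix : ∀ {n} → Adj n → Subset n → Fin n → Fin n → Bool
cutMatrix A X i j = lookup X i ∧ (not (lookup X j) ∧ A i j)

CutRankLt : ∀ {n} → Adj n → Subset n → ℕ → Set
CutRankLt A X k = ∃ λ r → r < k × RankLe (cutMatrix A X) r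

Family : ℕ → Set
Family n = Subset n → Bool

record IsTangle {n} (A : Adj n) (k : ℕ) (𝒯 : Family n) : Set where
  field
    inSk      : ∀ X → 𝒯 X ≡ true → CutRankLt A X k
    exactlyOne : ∀ X → CutRankLt A X k → 𝒯 (∁ X) ≡ not (𝒯 X)
    noTriple  : ∀ X Y Z → 𝒯 X ≡ true → 𝒯 Y ≡ true → 𝒯 Z ≡ true → (X ∪ (Y ∪ Z)) ≢ ⊤
    noBig     : ∀ X → 𝒯 X ≡ true → suc ∣ X ∣ ≢ n

Induces : ∀ {n} → Adj (suc n) → Fin (suc n) → ℕ → Family n → Family (suc n) → Set
Induces A v k 𝒯₀ 𝒯 = ∀ X → (𝒯 X ≡ true → CutRankLt A X k × 𝒯₀ (restrict v X) ≡ true)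
                         × (CutRankLt A X k → 𝒯₀ (restrict v X) ≡ true → 𝒯 X ≡ true)

Splits : ∀ {n} → Adj (suc n) → Fin (suc n) → Adj n → ℕ → Family (suc n) → Set
Splits {n} A v H k 𝒯 = Σ (Family n) λ 𝒯₁ → Σ (Family n) λ 𝒯₂ →
    IsTangle H k 𝒯₁ × IsTangle H k 𝒯₂ × ¬ (∀ X → 𝒯₁ X ≡ 𝒯₂ X)
    × Induces A v k 𝒯₁ 𝒯 × Induces A v k 𝒯₂ 𝒯

NoSplit : ∀ {n} → Adj (suc n) → Fin (suc n) → Adj n → Set
NoSplit A v H = ∀ (k : ℕ) → 0 < k → ∀ (𝒯 : Family _) → IsTangle A k 𝒯 → ¬ Splits A v H k 𝒯

-- If a tangle of order k in CR(G) splits in CR(H), the two tangles of CR(H) inducing it disagree on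
-- some A ⊆ V(H); then A and V(H) ∖ A have cut-rank < k in H, while by the tangle axioms neither is
-- the union of two of its subsets of cut-rank < k in G.  Such distinguishing sets cannot exist both
-- for G − v and for (G × vw) − v: a separation (B, B̄) of (G × vw) − v with w ∉ B gives
-- rank G[B ∪ v, B̄ ∪ v] ≤ ρ(B) + 1, and submodularity of rank, applied to this matrix and to the
-- cut matrix G[A, Ā] of A in G − v, bounds ρ_G(A ∩ B) + ρ_G(Ā ∩ B̄) and ρ_G(A ∩ B̄) + ρ_G(Ā ∩ B);
-- the resulting alternatives contradict the non-coverability of A, Ā, B and B̄.  Distinguishing
-- sets of G − v can be searched for exhaustively, which decides which of the two graphs to take.

module Submission where

open import Defs
open import Algebra.Bundles using (CommutativeRing)
import Algebra.Lattice.Properties.BooleanAlgebra as BooleanAlgebraProperties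
open import Data.Bool using (Bool; true; false; _∧_; _∨_; not; _xor_)
open import Data.Bool.Properties
  using (∧-comm; ∧-assoc; ∧-zeroʳ; ∧-identityʳ; xor-identityʳ; xor-assoc; xor-comm; xor-same;
         ∧-distribˡ-xor; ∧-distribʳ-xor; xor-∧-commutativeRing)
import Data.Bool.Properties as Bool
open import Data.Bool.Solver using (module xor-∧-Solver)
open import Data.Empty using (⊥; ⊥-elim)
open import Data.Fin using (Fin; zero; suc; _↑ˡ_; _↑ʳ_; splitAt; _≟_; punchIn; punchOut)
open import Data.Fin.Properties using (all?; punchIn-punchOut; punchInᵢ≢i; punchIn-injective)
open import Data.Fin.Subset using (Subset; ∁; _∩_; _∪_; ⊤; _⊆_)
open import Data.Fin.Subset.Properties
  using (∪-∩-booleanAlgebra; _∈?_; _⊆?_; ⊆⊤; ⊆-refl; ⊆-antisym; x∈p∪q⁺; x∈p∩q⁺; x∉p⇒x∈∁p;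
         p⊆p∪q; p∩q⊆p; p∩q⊆q; p⊆q⇒∁p⊇∁q; anySubset?)
open import Data.Nat using (ℕ; zero; suc; _+_; _≤_; _<_; _<?_; z≤n; s≤s)
open import Data.Nat.Properties using (+-suc; +-comm; ≤-trans; ≤-total; +-mono-≤; <-irrefl; ≮⇒≥; anyUpTo?)
open import Data.Product using (∃; ∃₂; _×_; _,_; proj₁; proj₂)
open import Data.Sum using (_⊎_; inj₁; inj₂)
import Data.Sum as Sum
open import Data.Vec using (Vec; insertAt)
import Data.Vec as Vec
open import Data.Vec.Properties
  using (insertAt-lookup; insertAt-punchIn; map-insertAt; lookup-map; lookup-zipWith;
         tabulate-cong; tabulate∘lookup; tabulate-∘)
open import Data.Vec.Functional using (Vector; _∷_; _++_; map; zipWith)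
open import Data.Vec.Functional.Properties using (lookup-++ˡ; lookup-++ʳ)
open import Function using (_∘_)
open import Relation.Binary.PropositionalEquality
  using (_≡_; _≢_; _≗_; refl; sym; trans; cong; cong₂; subst; subst₂; module ≡-Reasoning)
open import Relation.Nullary using (¬_; Dec; yes; no)
open import Relation.Nullary.Decidable
  using (map′; ¬?; _×-dec_; decidable-stable; dec-true; dec-false; isYes≗does)
open import Algebra.Properties.CommutativeSemigroup
  (CommutativeRing.+-commutativeSemigroup xor-∧-commutativeRing) using (interchange)

∧-swap : ∀ a b c → a ∧ (b ∧ c) ≡ b ∧ (a ∧ c)
∧-swap true  b c = refl
∧-swap false b c = sym (∧-zeroʳ b)

xor≡false⇒≡ : ∀ {a b} → a xor b ≡ false → a ≡ b
xor≡false⇒≡ {false} {false} _ = refl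
xor≡false⇒≡ {true}  {true}  _ = refl

xor-cancel : ∀ a b → a xor (b xor a) ≡ b
xor-cancel a b = begin
  a xor (b xor a) ≡⟨ cong (a xor_) (xor-comm b a) ⟩
  a xor (a xor b) ≡⟨ sym (xor-assoc a a b) ⟩
  (a xor a) xor b ≡⟨ cong (_xor b) (xor-same a) ⟩
  b               ∎
  where open ≡-Reasoning

infix 8 _·_

_·_ : ∀ {r} → Vector Bool r → Vector Bool r → Bool
_·_ {r} = dot r

0ᵥ : ∀ {r} → Vector Bool r
0ᵥ _ = false

Matrix : ℕ → ℕ → Set
Matrix m p = Fin m → Fin p → Bool

col : ∀ {m p} → Matrix m p → Fin p → Vector Bool m
col M j i = M i j

·-cong : ∀ {r} {u u′ w w′ : Vector Bool r} → u ≗ u′ → w ≗ w′ → u · w ≡ u′ · w′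
·-cong {zero}  _ _ = refl
·-cong {suc r} p q = cong₂ _xor_ (cong₂ _∧_ (p zero) (q zero)) (·-cong (p ∘ suc) (q ∘ suc))

·-zeroˡ : ∀ {r} (w : Vector Bool r) → 0ᵥ · w ≡ false
·-zeroˡ {zero}  w = refl
·-zeroˡ {suc r} w = ·-zeroˡ (w ∘ suc)

·-comm : ∀ {r} (u w : Vector Bool r) → u · w ≡ w · u
·-comm {zero}  u w = refl
·-comm {suc r} u w = cong₂ _xor_ (∧-comm (u zero) (w zero)) (·-comm (u ∘ suc) (w ∘ suc))

·-zeroʳ : ∀ {r} (u : Vector Bool r) → u · 0ᵥ ≡ false
·-zeroʳ u = trans (·-comm u 0ᵥ) (·-zeroˡ u)

·-distribʳ-xor : ∀ {r} (w x y : Vector Bool r) → zipWith _xor_ x y · w ≡ x · w xor y · w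
·-distribʳ-xor {zero}  w x y = refl
·-distribʳ-xor {suc r} w x y =
  trans (cong₂ _xor_ (∧-distribʳ-xor (w zero) (x zero) (y zero)) (·-distribʳ-xor (w ∘ suc) (x ∘ suc) (y ∘ suc)))
        (interchange (x zero ∧ w zero) (y zero ∧ w zero) _ _)

·-distribˡ-xor : ∀ {r} (u x y : Vector Bool r) → u · zipWith _xor_ x y ≡ u · x xor u · y
·-distribˡ-xor u x y = trans (·-comm u _) (trans (·-distribʳ-xor u x y) (cong₂ _xor_ (·-comm x u) (·-comm y u)))

·-scaleˡ : ∀ {r} c (x w : Vector Bool r) → map (c ∧_) x · w ≡ c ∧ x · w
·-scaleˡ {zero}  c x w = sym (∧-zeroʳ c)
·-scaleˡ {suc r} c x w =
  trans (cong₂ _xor_ (∧-assoc c (x zero) (w zero)) (·-scaleˡ c (x ∘ suc) (w ∘ suc)))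
        (sym (∧-distribˡ-xor c _ _))

·-scaleʳ : ∀ {r} c (u x : Vector Bool r) → u · map (c ∧_) x ≡ c ∧ u · x
·-scaleʳ c u x = trans (·-comm u _) (trans (·-scaleˡ c x u) (cong (c ∧_) (·-comm x u)))

·-assoc : ∀ {r s} (u : Vector Bool r) (C : Matrix r s) (w : Vector Bool s) →
  u · (λ t → C t · w) ≡ (λ q → u · col C q) · w
·-assoc {zero}  u C w = sym (·-zeroˡ w)
·-assoc {suc r} u C w =
  trans (cong₂ _xor_ (sym (·-scaleˡ (u zero) (C zero) w)) (·-assoc (u ∘ suc) (C ∘ suc) w))
        (sym (·-distribʳ-xor w (map (u zero ∧_) (C zero)) (λ q → (u ∘ suc) · col (C ∘ suc) q)))

·-split : ∀ {a b} (u w : Vector Bool (a + b)) →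
  u · w ≡ (u ∘ (_↑ˡ b)) · (w ∘ (_↑ˡ b)) xor (u ∘ (a ↑ʳ_)) · (w ∘ (a ↑ʳ_))
·-split {zero}  u w = refl
·-split {suc a} {b} u w = trans (cong ((u zero ∧ w zero) xor_) (·-split {a} {b} (u ∘ suc) (w ∘ suc)))
                            (sym (xor-assoc (u zero ∧ w zero) _ _))

·-++ : ∀ {a b} (u x : Vector Bool a) (y w : Vector Bool b) → (u ++ y) · (x ++ w) ≡ u · x xor y · w
·-++ {a} {b} u x y w = trans (·-split {a} {b} (u ++ y) (x ++ w))
  (cong₂ _xor_ (·-cong (lookup-++ˡ u y) (lookup-++ˡ x w)) (·-cong (lookup-++ʳ u y) (lookup-++ʳ x w)))

scaled-· : ∀ {r} c c′ (u x : Vector Bool r) → map (c ∧_) u · map (c′ ∧_) x ≡ c ∧ (c′ ∧ u · x)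
scaled-· c c′ u x = trans (·-scaleˡ c u _) (cong (c ∧_) (·-scaleʳ c′ u x))

col-++ : ∀ {a b p} (A : Matrix a p) (B : Matrix b p) j → col (A ++ B) j ≗ col A j ++ col B j
col-++ {a} A B j t with splitAt a t
... | inj₁ _ = refl
... | inj₂ _ = refl

mask : ∀ {m p} → Matrix m p → Vector Bool m → Vector Bool p → Matrix m p
mask M R C i j = R i ∧ (C j ∧ M i j)

RankLe-cong : ∀ {m p} {M M′ : Matrix m p} {r} → (∀ i j → M i j ≡ M′ i j) → RankLe M r → RankLe M′ r
RankLe-cong M≡M′ (B , C , M≡BC) = B , C , λ i j → trans (sym (M≡M′ i j)) (M≡BC i j)

RankLe-mask : ∀ {m p r} (M : Matrix m p) (R : Vector Bool m) (C : Vector Bool p) (B : Matrix m r) (K : Matrix r p) →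
  (∀ i j → R i ≡ true → C j ≡ true → M i j ≡ B i · col K j) → RankLe (mask M R C) r
RankLe-mask M R C B K M≡BK = (λ i → map (R i ∧_) (B i)) , (λ t j → C j ∧ K t j) , entry
  where
  entry : ∀ i j → mask M R C i j ≡ map (R i ∧_) (B i) · (λ t → C j ∧ K t j)
  entry i j with R i in Ri | C j in Cj
  ... | false | c     = sym (·-zeroˡ (λ t → c ∧ K t j))
  ... | true  | false = sym (·-zeroʳ (B i))
  ... | true  | true  = M≡BK i j Ri Cj

RankLe-transpose : ∀ {m p} {M : Matrix m p} {r} → RankLe M r → RankLe (λ j i → M i j) r
RankLe-transpose (B , C , M≡BC) = col C , (λ t i → B i t) , λ j i → trans (M≡BC i j) (·-comm (B i) _)

unitVector : ∀ {m} → Fin m → Vector Bool m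
unitVector zero    = true ∷ 0ᵥ
unitVector (suc i) = false ∷ unitVector i

unitVector-· : ∀ {m} (i : Fin m) (x : Vector Bool m) → unitVector i · x ≡ x i
unitVector-· zero    x = trans (cong (x zero xor_) (·-zeroˡ (x ∘ suc))) (xor-identityʳ (x zero))
unitVector-· (suc i) x = unitVector-· i (x ∘ suc)

RankLe-rows : ∀ {m p} (M : Matrix m p) → RankLe M m
RankLe-rows M = unitVector , M , λ i j → sym (unitVector-· i (col M j))

Searchable : (A : Set) → (A → A → Set) → Set₁
Searchable A _≈_ =
  ∀ (P : A → Set) → (∀ {x y} → x ≈ y → P x → P y) → (∀ x → Dec (P x)) → Dec (∃ P)

search-Bool : Searchable Bool _≡_
search-Bool P _ P? with P? true | P? false
... | yes p | _     = yes (true , p)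
... | no _  | yes p = yes (false , p)
... | no ¬t | no ¬f = no λ { (true , p) → ¬t p ; (false , p) → ¬f p }

search-Fin→ : ∀ {A : Set} {_≈_ : A → A → Set} → (∀ x → x ≈ x) → Searchable A _≈_ →
  ∀ m → Searchable (Fin m → A) (λ f g → ∀ i → f i ≈ g i)
search-Fin→ _ _ zero P resp P? =
  map′ (_ ,_) (λ { (f , p) → resp (λ ()) p }) (P? (λ ()))
search-Fin→ {A} {_≈_} refl≈ search (suc m) P resp P? =
  map′ (λ { (a , f , p) → a ∷ f , p }) (λ { (f , p) → f zero , f ∘ suc , resp (η f) p })
       (search (λ a → ∃ λ f → P (a ∷ f)) (λ a≈b (f , p) → f , resp (cons-cong a≈b (refl≈ ∘ f)) p)
               (λ a → search-Fin→ refl≈ search m (λ f → P (a ∷ f)) (resp ∘ cons-cong (refl≈ a)) (P? ∘ (a ∷_))))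
  where
  η : ∀ (f : Fin (suc m) → A) i → f i ≈ (f zero ∷ f ∘ suc) i
  η f zero    = refl≈ (f zero)
  η f (suc i) = refl≈ (f (suc i))
  cons-cong : ∀ {a b} → a ≈ b → ∀ {f g : Fin m → A} → (∀ i → f i ≈ g i) → ∀ i → (a ∷ f) i ≈ (b ∷ g) i
  cons-cong a≈b f≈g zero    = a≈b
  cons-cong a≈b f≈g (suc i) = f≈g i

search-Vector : ∀ r → Searchable (Vector Bool r) _≗_
search-Vector = search-Fin→ (λ _ → refl) search-Bool

RankLe? : ∀ {m p} (M : Matrix m p) r → Dec (RankLe M r)
RankLe? {m} {p} M r =
  search-Fin→ (λ _ _ → refl) (search-Vector r) m (λ B → ∃ λ C → ∀ i j → M i j ≡ B i · col C j)
    (λ B≈B′ (C , h) → C , λ i j → trans (h i j) (·-cong (B≈B′ i) (λ _ → refl)))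
    (λ B → search-Fin→ (λ _ _ → refl) (search-Vector p) r (λ C → ∀ i j → M i j ≡ B i · col C j)
             (λ C≈C′ h i j → trans (h i j) (·-cong (λ _ → refl) (λ t → C≈C′ t j)))
             (λ C → all? λ i → all? λ j → M i j Bool.≟ B i · col C j))

CutRankLt? : ∀ {n} (A : Adj n) X k → Dec (CutRankLt A X k)
CutRankLt? A X = anyUpTo? (RankLe? (cutMatrix A X))

record RowReduction {m p} (R : Matrix m p) : Set where
  field
    rank nullity      : ℕ
    nullity+rank≤rows : nullity + rank ≤ m
    basis             : Matrix rank p
    coords            : Matrix m rank
    rows≡coords·basis : ∀ t j → R t j ≡ coords t · col basis j
    basisFromRows     : Matrix rank m
    basis≡·rows       : ∀ s j → basis s j ≡ basisFromRows s · col R j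
    kernelBasis       : Matrix nullity m
    kernel-spanned    : ∀ u → (∀ j → u · col R j ≡ false) →
                        ∃ λ z → ∀ t → u t ≡ z · col kernelBasis t

open RowReduction

InRowSpace : ∀ {d p} → Vector Bool p → Matrix d p → Set
InRowSpace x D = ∃ λ e → ∀ j → x j ≡ e · col D j

addDependentRow : ∀ {m p} (R : Matrix (suc m) p) (ρ : RowReduction (R ∘ suc)) →
  InRowSpace (R zero) (basis ρ) → RowReduction R
addDependentRow {m} R ρ (e , R₀≡e·basis) = record
  { rank = rank ρ ; nullity = suc (nullity ρ) ; nullity+rank≤rows = s≤s (nullity+rank≤rows ρ)
  ; basis = basis ρ ; coords = e ∷ coords ρ
  ; rows≡coords·basis = λ { zero j → R₀≡e·basis j ; (suc t) j → rows≡coords·basis ρ t j }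
  ; basisFromRows = λ s → false ∷ basisFromRows ρ s ; basis≡·rows = basis≡·rows ρ
  ; kernelBasis = (true ∷ w) ∷ (λ s → false ∷ kernelBasis ρ s)
  ; kernel-spanned = kernel }
  where
  open ≡-Reasoning
  w : Vector Bool m
  w t = e · col (basisFromRows ρ) t
  w·rows : ∀ j → w · col (R ∘ suc) j ≡ R zero j
  w·rows j = begin
    w · col (R ∘ suc) j                               ≡⟨ ·-assoc e (basisFromRows ρ) (col (R ∘ suc) j) ⟨
    e · (λ s → basisFromRows ρ s · col (R ∘ suc) j)   ≡⟨ ·-cong (λ _ → refl) (λ s → basis≡·rows ρ s j) ⟨
    e · col (basis ρ) j                               ≡⟨ R₀≡e·basis j ⟨
    R zero j                                          ∎
  kernel : ∀ u → (∀ j → u · col R j ≡ false) →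
    ∃ λ z → ∀ t → u t ≡ z · col ((true ∷ w) ∷ (λ s → false ∷ kernelBasis ρ s)) t
  kernel u u·R≡0 = u zero ∷ z , spans
    where
    u′ : Vector Bool m
    u′ = zipWith _xor_ (u ∘ suc) (map (u zero ∧_) w)
    u′·R≡0 : ∀ j → u′ · col (R ∘ suc) j ≡ false
    u′·R≡0 j = begin
      u′ · col (R ∘ suc) j                                           ≡⟨ ·-distribʳ-xor _ (u ∘ suc) _ ⟩
      (u ∘ suc) · col (R ∘ suc) j xor map (u zero ∧_) w · col (R ∘ suc) j
        ≡⟨ cong ((u ∘ suc) · col (R ∘ suc) j xor_) (trans (·-scaleˡ (u zero) w _) (cong (u zero ∧_) (w·rows j))) ⟩
      (u ∘ suc) · col (R ∘ suc) j xor (u zero ∧ R zero j)            ≡⟨ xor-comm _ (u zero ∧ R zero j) ⟩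
      u · col R j                                                    ≡⟨ u·R≡0 j ⟩
      false                                                          ∎
    z = proj₁ (kernel-spanned ρ u′ u′·R≡0)
    spans : ∀ t → u t ≡ (u zero ∷ z) · col ((true ∷ w) ∷ (λ s → false ∷ kernelBasis ρ s)) t
    spans zero = sym (trans (cong₂ _xor_ (∧-identityʳ (u zero)) (·-zeroʳ z)) (xor-identityʳ (u zero)))
    spans (suc t) = sym (begin
      (u zero ∧ w t) xor z · col (kernelBasis ρ) t
        ≡⟨ cong ((u zero ∧ w t) xor_) (proj₂ (kernel-spanned ρ u′ u′·R≡0) t) ⟨
      (u zero ∧ w t) xor (u (suc t) xor (u zero ∧ w t)) ≡⟨ xor-cancel (u zero ∧ w t) (u (suc t)) ⟩
      u (suc t)                                        ∎)

addIndependentRow : ∀ {m p} (R : Matrix (suc m) p) (ρ : RowReduction (R ∘ suc)) →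
  ¬ InRowSpace (R zero) (basis ρ) → RowReduction R
addIndependentRow {m} R ρ R₀∉span = record
  { rank = suc (rank ρ) ; nullity = nullity ρ
  ; nullity+rank≤rows = subst (_≤ suc m) (sym (+-suc (nullity ρ) (rank ρ))) (s≤s (nullity+rank≤rows ρ))
  ; basis = R zero ∷ basis ρ ; coords = unitVector zero ∷ (λ t → false ∷ coords ρ t)
  ; rows≡coords·basis = λ { zero j → sym (unitVector-· zero (col (R zero ∷ basis ρ) j))
                          ; (suc t) j → rows≡coords·basis ρ t j }
  ; basisFromRows = unitVector zero ∷ (λ s → false ∷ basisFromRows ρ s)
  ; basis≡·rows = λ { zero j → sym (unitVector-· zero (col R j)) ; (suc s) j → basis≡·rows ρ s j }
  ; kernelBasis = λ s → false ∷ kernelBasis ρ s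
  ; kernel-spanned = kernel }
  where
  kernel : ∀ u → (∀ j → u · col R j ≡ false) → ∃ λ z → ∀ t → u t ≡ z · col (λ s → false ∷ kernelBasis ρ s) t
  kernel u u·R≡0 with u zero in u₀
  ... | true = ⊥-elim (R₀∉span (e , λ j → trans (xor≡false⇒≡ (u·R≡0 j)) (tail-u·R j)))
    where
    e = λ s → (u ∘ suc) · col (coords ρ) s
    tail-u·R : ∀ j → (u ∘ suc) · col (R ∘ suc) j ≡ e · col (basis ρ) j
    tail-u·R j = trans (·-cong (λ _ → refl) (λ t → rows≡coords·basis ρ t j))
                       (·-assoc (u ∘ suc) (coords ρ) (col (basis ρ) j))
  ... | false = z , spans
    where
    z = proj₁ (kernel-spanned ρ (u ∘ suc) u·R≡0)
    spans : ∀ t → u t ≡ z · col (λ s → false ∷ kernelBasis ρ s) t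
    spans zero    = trans u₀ (sym (·-zeroʳ z))
    spans (suc t) = proj₂ (kernel-spanned ρ (u ∘ suc) u·R≡0) t

rowReduce : ∀ {m p} (R : Matrix m p) → RowReduction R
rowReduce {zero} R = record
  { rank = 0 ; nullity = 0 ; nullity+rank≤rows = z≤n ; basis = λ () ; coords = λ _ ()
  ; rows≡coords·basis = λ () ; basisFromRows = λ () ; basis≡·rows = λ ()
  ; kernelBasis = λ () ; kernel-spanned = λ u _ → (λ ()) , λ () }
rowReduce {suc m} {p} R with rowReduce (R ∘ suc)
... | ρ with search-Vector (rank ρ) (λ e → ∀ j → R zero j ≡ e · col (basis ρ) j)
               (λ e≗e′ h j → trans (h j) (·-cong e≗e′ (λ _ → refl)))
               (λ e → all? λ j → R zero j Bool.≟ e · col (basis ρ) j)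
...   | yes R₀∈span = addDependentRow R ρ R₀∈span
...   | no R₀∉span  = addIndependentRow R ρ R₀∉span

join-identity : ∀ r₁ r₂ c₁ c₂ m →
  ((c₁ ∧ c₂) ∧ (r₁ ∧ (r₁ ∧ (c₁ ∧ m)))) xor ((c₁ ∧ c₂) ∧ ((not r₁ ∧ r₂) ∧ (r₂ ∧ (c₂ ∧ m))))
    ≡ (r₁ ∨ r₂) ∧ ((c₁ ∧ c₂) ∧ m)
join-identity false false false _     _     = refl
join-identity false false true  false _     = refl
join-identity false false true  true  _     = refl
join-identity false true  false _     _     = refl
join-identity false true  true  false _     = refl
join-identity false true  true  true  _     = refl
join-identity true  _     false _     _     = refl
join-identity true  _     true  false _     = refl
join-identity true  _     true  true  true  = refl
join-identity true  _     true  true  false = refl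

kernel-identity : ∀ r₁ r₂ c₁ c₂ m →
  ((c₁ ∧ c₂) ∧ ((r₁ ∧ r₂) ∧ (r₁ ∧ (c₁ ∧ m)))) xor ((c₁ ∧ c₂) ∧ ((r₁ ∧ r₂) ∧ (r₂ ∧ (c₂ ∧ m)))) ≡ false
kernel-identity _     _     false _     _     = refl
kernel-identity _     _     true  false _     = refl
kernel-identity false _     true  true  _     = refl
kernel-identity true  false true  true  _     = refl
kernel-identity true  true  true  true  true  = refl
kernel-identity true  true  true  true  false = refl

meet-identity : ∀ r₁ r₂ c₁ c₂ m →
  ((r₁ ∧ r₂) ∧ (c₁ ∧ (r₁ ∧ (c₁ ∧ m)))) xor ((r₁ ∧ r₂) ∧ ((not c₁ ∧ c₂) ∧ (r₂ ∧ (c₂ ∧ m))))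
    ≡ (r₁ ∧ r₂) ∧ ((c₁ ∨ c₂) ∧ m)
meet-identity false _     _     _     _     = refl
meet-identity true  false _     _     _     = refl
meet-identity true  true  true  _     true  = refl
meet-identity true  true  true  _     false = refl
meet-identity true  true  false true  _     = refl
meet-identity true  true  false false _     = refl

-- Stack the right factors of both factorisations, restricted to the columns C₁ ∩ C₂: rows of the
-- join factor through its row space, rows of the meet through its left kernel, and the two
-- dimensions add up to at most a + b.
module Submodularity {m p} (M : Matrix m p) (R₁ R₂ : Vector Bool m) (C₁ C₂ : Vector Bool p) {a b}
  (B₁ : Matrix m a) (K₁ : Matrix a p) (M₁≡B₁K₁ : ∀ i j → mask M R₁ C₁ i j ≡ B₁ i · col K₁ j)
  (B₂ : Matrix m b) (K₂ : Matrix b p) (M₂≡B₂K₂ : ∀ i j → mask M R₂ C₂ i j ≡ B₂ i · col K₂ j) where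

  open ≡-Reasoning

  J : Vector Bool p
  J = zipWith _∧_ C₁ C₂

  stacked : Matrix (a + b) p
  stacked = (λ t j → J j ∧ K₁ t j) ++ (λ t j → J j ∧ K₂ t j)

  ρ : RowReduction stacked
  ρ = rowReduce stacked

  rows : Bool → Bool → Fin m → Vector Bool (a + b)
  rows r₁ r₂ i = map (r₁ ∧_) (B₁ i) ++ map (r₂ ∧_) (B₂ i)

  rows·stacked : ∀ r₁ r₂ i j → rows r₁ r₂ i · col stacked j
    ≡ (J j ∧ (r₁ ∧ mask M R₁ C₁ i j)) xor (J j ∧ (r₂ ∧ mask M R₂ C₂ i j))
  rows·stacked r₁ r₂ i j = begin
    rows r₁ r₂ i · col stacked j
      ≡⟨ ·-cong (λ _ → refl) (col-++ (λ t j → J j ∧ K₁ t j) (λ t j → J j ∧ K₂ t j) j) ⟩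
    rows r₁ r₂ i · (map (J j ∧_) (col K₁ j) ++ map (J j ∧_) (col K₂ j))
      ≡⟨ ·-++ (map (r₁ ∧_) (B₁ i)) (map (J j ∧_) (col K₁ j)) (map (r₂ ∧_) (B₂ i)) (map (J j ∧_) (col K₂ j)) ⟩
    map (r₁ ∧_) (B₁ i) · map (J j ∧_) (col K₁ j) xor map (r₂ ∧_) (B₂ i) · map (J j ∧_) (col K₂ j)
      ≡⟨ cong₂ _xor_ (scaled-· r₁ (J j) (B₁ i) _) (scaled-· r₂ (J j) (B₂ i) _) ⟩
    (r₁ ∧ (J j ∧ B₁ i · col K₁ j)) xor (r₂ ∧ (J j ∧ B₂ i · col K₂ j))
      ≡⟨ cong₂ _xor_ (cong (λ x → r₁ ∧ (J j ∧ x)) (M₁≡B₁K₁ i j)) (cong (λ x → r₂ ∧ (J j ∧ x)) (M₂≡B₂K₂ i j)) ⟨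
    (r₁ ∧ (J j ∧ mask M R₁ C₁ i j)) xor (r₂ ∧ (J j ∧ mask M R₂ C₂ i j))
      ≡⟨ cong₂ _xor_ (∧-swap r₁ (J j) _) (∧-swap r₂ (J j) _) ⟩
    (J j ∧ (r₁ ∧ mask M R₁ C₁ i j)) xor (J j ∧ (r₂ ∧ mask M R₂ C₂ i j)) ∎

  join-rank : RankLe (mask M (zipWith _∨_ R₁ R₂) (zipWith _∧_ C₁ C₂)) (rank ρ)
  join-rank = (λ i s → joinRow i · col (coords ρ) s) , basis ρ , join
    where
    joinRow : Fin m → Vector Bool (a + b)
    joinRow i = rows (R₁ i) (not (R₁ i) ∧ R₂ i) i
    join : ∀ i j → mask M (zipWith _∨_ R₁ R₂) (zipWith _∧_ C₁ C₂) i j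
                   ≡ (λ s → joinRow i · col (coords ρ) s) · col (basis ρ) j
    join i j = begin
      (R₁ i ∨ R₂ i) ∧ (J j ∧ M i j)   ≡⟨ join-identity (R₁ i) (R₂ i) (C₁ j) (C₂ j) (M i j) ⟨
      _                              ≡⟨ rows·stacked (R₁ i) (not (R₁ i) ∧ R₂ i) i j ⟨
      joinRow i · col stacked j      ≡⟨ ·-cong (λ _ → refl) (λ t → rows≡coords·basis ρ t j) ⟩
      _                              ≡⟨ ·-assoc (joinRow i) (coords ρ) (col (basis ρ) j) ⟩
      _                              ∎

  meet-rank : RankLe (mask M (zipWith _∧_ R₁ R₂) (zipWith _∨_ C₁ C₂)) (nullity ρ)
  meet-rank = z , (λ s j → kernelBasis ρ s · columns j) , meet
    where
    meetRow : Fin m → Vector Bool (a + b)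
    meetRow i = rows (R₁ i ∧ R₂ i) (R₁ i ∧ R₂ i) i
    inKernel : ∀ i j → meetRow i · col stacked j ≡ false
    inKernel i j = trans (rows·stacked _ _ i j) (kernel-identity (R₁ i) (R₂ i) (C₁ j) (C₂ j) (M i j))
    z : Matrix m (nullity ρ)
    z i = proj₁ (kernel-spanned ρ _ (inKernel i))
    columns : Fin p → Vector Bool (a + b)
    columns j = map (C₁ j ∧_) (col K₁ j) ++ map ((not (C₁ j) ∧ C₂ j) ∧_) (col K₂ j)
    meet : ∀ i j → mask M (zipWith _∧_ R₁ R₂) (zipWith _∨_ C₁ C₂) i j
                   ≡ z i · (λ s → kernelBasis ρ s · columns j)
    meet i j = begin
      (R₁ i ∧ R₂ i) ∧ ((C₁ j ∨ C₂ j) ∧ M i j)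
        ≡⟨ meet-identity (R₁ i) (R₂ i) (C₁ j) (C₂ j) (M i j) ⟨
      _ ≡⟨ cong₂ _xor_ (cong (λ x → r ∧ (C₁ j ∧ x)) (M₁≡B₁K₁ i j))
                       (cong (λ x → r ∧ ((not (C₁ j) ∧ C₂ j) ∧ x)) (M₂≡B₂K₂ i j)) ⟩
      _ ≡⟨ cong₂ _xor_ (scaled-· r (C₁ j) (B₁ i) _) (scaled-· r _ (B₂ i) _) ⟨
      _ ≡⟨ ·-++ (map (r ∧_) (B₁ i)) (map (C₁ j ∧_) (col K₁ j)) (map (r ∧_) (B₂ i))
                (map ((not (C₁ j) ∧ C₂ j) ∧_) (col K₂ j)) ⟨
      meetRow i · columns j
        ≡⟨ ·-cong (proj₂ (kernel-spanned ρ _ (inKernel i))) (λ _ → refl) ⟩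
      _ ≡⟨ ·-assoc (z i) (kernelBasis ρ) (columns j) ⟨
      _ ∎
      where r = R₁ i ∧ R₂ i

mask-submodular : ∀ {m p} (M : Matrix m p) (R₁ R₂ : Vector Bool m) (C₁ C₂ : Vector Bool p) {a b} →
  RankLe (mask M R₁ C₁) a → RankLe (mask M R₂ C₂) b →
  ∃₂ λ c d → c + d ≤ a + b
    × RankLe (mask M (zipWith _∧_ R₁ R₂) (zipWith _∨_ C₁ C₂)) c
    × RankLe (mask M (zipWith _∨_ R₁ R₂) (zipWith _∧_ C₁ C₂)) d
mask-submodular M R₁ R₂ C₁ C₂ (B₁ , K₁ , M₁≡B₁K₁) (B₂ , K₂ , M₂≡B₂K₂) =
  nullity ρ , rank ρ , nullity+rank≤rows ρ , meet-rank , join-rank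
  where open Submodularity M R₁ R₂ C₁ C₂ B₁ K₁ M₁≡B₁K₁ B₂ K₂ M₂≡B₂K₂

localComp-diag : ∀ {n} (A : Adj n) u x → localComp A u x x ≡ A x x
localComp-diag A u x rewrite isYes≗does (x ≟ x) | dec-true (x ≟ x) refl =
  trans (cong (λ b → A x x xor (A u x ∧ b)) (∧-zeroʳ (A u x)))
        (trans (cong (A x x xor_) (∧-zeroʳ (A u x))) (xor-identityʳ (A x x)))

localComp-off : ∀ {n} (A : Adj n) u {x y} → x ≢ y → localComp A u x y ≡ A x y xor (A u x ∧ A u y)
localComp-off A u {x} {y} x≢y rewrite isYes≗does (x ≟ y) | dec-false (x ≟ y) x≢y =
  cong (λ b → A x y xor (A u x ∧ b)) (∧-identityʳ (A u y))

localComp-row : ∀ {n} (A : Adj n) {u} y → A u u ≡ false → localComp A u u y ≡ A u y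
localComp-row A y Auu≡0 rewrite Auu≡0 = xor-identityʳ _

localComp-col : ∀ {n} (A : Adj n) {u} x → A u u ≡ false → localComp A u x u ≡ A x u
localComp-col A {u} x Auu≡0 rewrite Auu≡0 =
  trans (cong (A x u xor_) (∧-zeroʳ (A u x))) (xor-identityʳ _)

module _ {n} {G : Adj n} (simple : IsSimple G) {v w : Fin n} (vw : G v w ≡ true) where
  open ≡-Reasoning

  private
    G₁ = localComp G v
    G₂ = localComp G₁ w
    Gvv≡0 = proj₂ simple v

    G₁-row-v : ∀ x → G₁ v x ≡ G v x
    G₁-row-v x = localComp-row G x Gvv≡0

    G₁-row-w : ∀ {x} → w ≢ x → G₁ w x ≡ G w x xor G v x
    G₁-row-w {x} w≢x = trans (localComp-off G v w≢x) (cong (λ b → G w x xor (b ∧ G v x)) vw)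

    G₁wv≡1 : G₁ w v ≡ true
    G₁wv≡1 = trans (localComp-col G w Gvv≡0) (trans (proj₁ simple w v) vw)

    G₂-row-v : ∀ {x} → v ≢ x → w ≢ x → G₂ v x ≡ G w x
    G₂-row-v {x} v≢x w≢x = begin
      G₂ v x                          ≡⟨ localComp-off G₁ w v≢x ⟩
      G₁ v x xor (G₁ w v ∧ G₁ w x)     ≡⟨ cong₂ (λ a b → a xor (b ∧ G₁ w x)) (G₁-row-v x) G₁wv≡1 ⟩
      G v x xor G₁ w x                 ≡⟨ cong (G v x xor_) (G₁-row-w w≢x) ⟩
      G v x xor (G w x xor G v x)      ≡⟨ xor-cancel (G v x) (G w x) ⟩
      G w x                            ∎

  pivot-off : ∀ {x y} → x ≢ y → v ≢ x → v ≢ y → w ≢ x → w ≢ y →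
    pivot G v w x y ≡ G x y xor ((G v x ∧ G w y) xor (G w x ∧ G v y))
  pivot-off {x} {y} x≢y v≢x v≢y w≢x w≢y = begin
    pivot G v w x y                                     ≡⟨ localComp-off G₂ v x≢y ⟩
    G₂ x y xor (G₂ v x ∧ G₂ v y)
      ≡⟨ cong₂ (λ a b → G₂ x y xor (a ∧ b)) (G₂-row-v v≢x w≢x) (G₂-row-v v≢y w≢y) ⟩
    G₂ x y xor (G w x ∧ G w y)                           ≡⟨ cong (_xor (G w x ∧ G w y)) (localComp-off G₁ w x≢y) ⟩
    (G₁ x y xor (G₁ w x ∧ G₁ w y)) xor (G w x ∧ G w y)
      ≡⟨ cong₂ (λ a b → (a xor b) xor (G w x ∧ G w y)) (localComp-off G v x≢y)
               (cong₂ _∧_ (G₁-row-w w≢x) (G₁-row-w w≢y)) ⟩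
    ((G x y xor (G v x ∧ G v y)) xor ((G w x xor G v x) ∧ (G w y xor G v y))) xor (G w x ∧ G w y)
      ≡⟨ expand (G x y) (G v x) (G v y) (G w x) (G w y) ⟩
    G x y xor ((G v x ∧ G w y) xor (G w x ∧ G v y))     ∎
    where
    open xor-∧-Solver
    expand : ∀ a b c d e → ((a xor (b ∧ c)) xor ((d xor b) ∧ (e xor c))) xor (d ∧ e) ≡ a xor ((b ∧ e) xor (d ∧ c))
    expand = solve 5 (λ a b c d e → ((a :+ (b :* c)) :+ ((d :+ b) :* (e :+ c))) :+ (d :* e)
                                     := a :+ ((b :* e) :+ (d :* c))) refl

  pivot-column : ∀ {x} → x ≢ w → v ≢ x → pivot G v w x w ≡ G v x
  pivot-column {x} x≢w v≢x = begin
    pivot G v w x w                          ≡⟨ localComp-off G₂ v x≢w ⟩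
    G₂ x w xor (G₂ v x ∧ G₂ v w)
      ≡⟨ cong₂ (λ a b → a xor (b ∧ G₂ v w)) (localComp-col G₁ x G₁ww≡0) (G₂-row-v v≢x (x≢w ∘ sym)) ⟩
    G₁ x w xor (G w x ∧ G₂ v w)               ≡⟨ cong₂ (λ a b → a xor (G w x ∧ b)) (localComp-off G v x≢w) G₂vw≡1 ⟩
    (G x w xor (G v x ∧ G v w)) xor (G w x ∧ true)
      ≡⟨ cong₂ (λ a b → (a xor (G v x ∧ b)) xor (G w x ∧ true)) (proj₁ simple x w) vw ⟩
    (G w x xor (G v x ∧ true)) xor (G w x ∧ true)
      ≡⟨ cong₂ (λ a b → (G w x xor a) xor b) (∧-identityʳ (G v x)) (∧-identityʳ (G w x)) ⟩
    (G w x xor G v x) xor G w x              ≡⟨ xor-assoc (G w x) (G v x) (G w x) ⟩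
    G w x xor (G v x xor G w x)              ≡⟨ xor-cancel (G w x) (G v x) ⟩
    G v x                                    ∎
    where
    G₁ww≡0 : G₁ w w ≡ false
    G₁ww≡0 = trans (localComp-diag G v w) (proj₂ simple w)
    G₂vw≡1 : G₂ v w ≡ true
    G₂vw≡1 = trans (localComp-col G₁ v G₁ww≡0) (trans (G₁-row-v w) vw)

  entry-via-pivot : ∀ {x y} → x ≢ y → v ≢ x → v ≢ y → w ≢ x → w ≢ y →
    G x y ≡ (G w x ∧ G v y) xor (pivot G v w x y xor (G w y ∧ pivot G v w x w))
  entry-via-pivot {x} {y} x≢y v≢x v≢y w≢x w≢y = sym (begin
    (G w x ∧ G v y) xor (pivot G v w x y xor (G w y ∧ pivot G v w x w))
      ≡⟨ cong₂ (λ a b → (G w x ∧ G v y) xor (a xor (G w y ∧ b)))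
               (pivot-off x≢y v≢x v≢y w≢x w≢y) (pivot-column (w≢x ∘ sym) v≢x) ⟩
    (G w x ∧ G v y) xor ((G x y xor ((G v x ∧ G w y) xor (G w x ∧ G v y))) xor (G w y ∧ G v x))
      ≡⟨ cancel (G x y) (G v x) (G w x) (G v y) (G w y) ⟩
    G x y ∎)
    where
    open xor-∧-Solver
    cancel : ∀ a b c d e → (c ∧ d) xor ((a xor ((b ∧ e) xor (c ∧ d))) xor (e ∧ b)) ≡ a
    cancel = solve 5 (λ a b c d e → (c :* d) :+ ((a :+ ((b :* e) :+ (c :* d))) :+ (e :* b)) := a) refl

module _ {n : ℕ} where
  open BooleanAlgebraProperties (∪-∩-booleanAlgebra n) public
    using (deMorgan₁) renaming (¬-involutive to ∁-involutive)

zipWith-insertAt : ∀ {A B C : Set} (f : A → B → C) {n} (xs : Vec A n) (ys : Vec B n) i x y →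
  Vec.zipWith f (insertAt xs i x) (insertAt ys i y) ≡ insertAt (Vec.zipWith f xs ys) i (f x y)
zipWith-insertAt f xs ys zero x y = refl
zipWith-insertAt f (x′ Vec.∷ xs) (y′ Vec.∷ ys) (suc i) x y = cong (f x′ y′ Vec.∷_) (zipWith-insertAt f xs ys i x y)

∪-≡⊤ : ∀ {n} {S T : Subset n} → ∁ S ⊆ T → S ∪ T ≡ ⊤
∪-≡⊤ {S = S} {T} ∁S⊆T = ⊆-antisym ⊆⊤ covers
  where
  covers : ⊤ ⊆ S ∪ T
  covers {x} _ with x ∈? S
  ... | yes x∈S = x∈p∪q⁺ (inj₁ x∈S)
  ... | no x∉S  = x∈p∪q⁺ (inj₂ (∁S⊆T (x∉p⇒x∈∁p x∉S)))

⊆-∩-split : ∀ {n} (S T : Subset n) → S ⊆ (S ∩ T) ∪ (S ∩ ∁ T)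
⊆-∩-split S T {x} x∈S with x ∈? T
... | yes x∈T = x∈p∪q⁺ (inj₁ (x∈p∩q⁺ (x∈S , x∈T)))
... | no x∉T  = x∈p∪q⁺ (inj₂ (x∈p∩q⁺ (x∈S , x∉p⇒x∈∁p x∉T)))

⊆-∩-splitʳ : ∀ {n} (S T : Subset n) → S ⊆ (T ∩ S) ∪ (∁ T ∩ S)
⊆-∩-splitʳ S T {x} x∈S with x ∈? T
... | yes x∈T = x∈p∪q⁺ (inj₁ (x∈p∩q⁺ (x∈T , x∈S)))
... | no x∉T  = x∈p∪q⁺ (inj₂ (x∈p∩q⁺ (x∉p⇒x∈∁p x∉T , x∈S)))

data Position {n} (v : Fin (suc n)) : Fin (suc n) → Set where
  at  : Position v v
  off : ∀ i → Position v (punchIn v i)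

position : ∀ {n} (v x : Fin (suc n)) → Position v x
position v x with v ≟ x
... | yes refl = at
... | no v≢x   = subst (Position v) (punchIn-punchOut v≢x) (off (punchOut v≢x))

_[_,_] : ∀ {n} → Adj n → Subset n → Subset n → Matrix n n
G [ S , T ] = mask G (Vec.lookup S) (Vec.lookup T)

RankLe-cut : ∀ {n} (G : Adj n) X {r} → RankLe (G [ X , ∁ X ]) r → RankLe (cutMatrix G X) r
RankLe-cut G X = RankLe-cong λ i j → cong (λ b → Vec.lookup X i ∧ (b ∧ G i j)) (lookup-map j not X)

submatrix-transpose : ∀ {n} {G : Adj n} → IsSimple G → ∀ S T {r} → RankLe (G [ S , T ]) r → RankLe (G [ T , S ]) r
submatrix-transpose {G = G} (symmetric , _) S T h = RankLe-cong entry (RankLe-transpose h)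
  where
  entry : ∀ i j → (G [ S , T ]) j i ≡ (G [ T , S ]) i j
  entry i j = trans (∧-swap (Vec.lookup S j) (Vec.lookup T i) (G j i))
                    (cong (λ b → Vec.lookup T i ∧ (Vec.lookup S j ∧ b)) (symmetric j i))

submatrix-submodular : ∀ {n} (G : Adj n) (S₁ T₁ S₂ T₂ : Subset n) {a b} →
  RankLe (G [ S₁ , T₁ ]) a → RankLe (G [ S₂ , T₂ ]) b →
  ∃₂ λ c d → c + d ≤ a + b × RankLe (G [ S₁ ∩ S₂ , T₁ ∪ T₂ ]) c × RankLe (G [ S₁ ∪ S₂ , T₁ ∩ T₂ ]) d
submatrix-submodular G S₁ T₁ S₂ T₂ h₁ h₂
  with mask-submodular G (Vec.lookup S₁) (Vec.lookup S₂) (Vec.lookup T₁) (Vec.lookup T₂) h₁ h₂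
... | c , d , c+d≤a+b , meet , join =
  c , d , c+d≤a+b , RankLe-cong (lookups _∧_ _∨_) meet , RankLe-cong (lookups _∨_ _∧_) join
  where
  lookups : ∀ f g i j → f (Vec.lookup S₁ i) (Vec.lookup S₂ i) ∧ (g (Vec.lookup T₁ j) (Vec.lookup T₂ j) ∧ G i j)
                       ≡ (G [ Vec.zipWith f S₁ S₂ , Vec.zipWith g T₁ T₂ ]) i j
  lookups f g i j = sym (cong₂ (λ x y → x ∧ (y ∧ G i j)) (lookup-zipWith f i S₁ S₂) (lookup-zipWith g j T₁ T₂))

module _ {n} (v : Fin (suc n)) where

  extend : Bool → Subset n → Subset (suc n)
  extend b X = insertAt X v b

  extend-∩ : ∀ b b′ X Y → extend b X ∩ extend b′ Y ≡ extend (b ∧ b′) (X ∩ Y)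
  extend-∩ b b′ X Y = zipWith-insertAt _∧_ X Y v b b′

  extend-∪ : ∀ b b′ X Y → extend b X ∪ extend b′ Y ≡ extend (b ∨ b′) (X ∪ Y)
  extend-∪ b b′ X Y = zipWith-insertAt _∨_ X Y v b b′

  ∁-extend : ∀ b X → ∁ (extend b X) ≡ extend (not b) (∁ X)
  ∁-extend b X = map-insertAt not b X v

  extend-∈ : ∀ {b X i} → Vec.lookup (extend b X) (punchIn v i) ≡ true → Vec.lookup X i ≡ true
  extend-∈ {b} {X} {i} = trans (sym (insertAt-punchIn X v b i))

  extend-∁-∈ : ∀ {b X i} → Vec.lookup (extend b (∁ X)) (punchIn v i) ≡ true → Vec.lookup X i ≡ false
  extend-∁-∈ {X = X} {i} i∈ =
    trans (sym (Bool.not-involutive _)) (cong not (trans (sym (lookup-map i not X)) (extend-∈ i∈)))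

  restrict-extend : ∀ b X → restrict v (extend b X) ≡ X
  restrict-extend b X = trans (tabulate-cong (insertAt-punchIn X v b)) (tabulate∘lookup X)

  restrict-∁ : ∀ X → restrict v (∁ X) ≡ ∁ (restrict v X)
  restrict-∁ X = trans (tabulate-cong (λ i → lookup-map (punchIn v i) not X)) (tabulate-∘ not _)

cutMatrix-support : ∀ {n} (A : Adj n) X {i j} → Vec.lookup X i ≡ true → Vec.lookup X j ≡ false →
  cutMatrix A X i j ≡ A i j
cutMatrix-support A X i∈X j∉X rewrite i∈X | j∉X = refl

punchIn-≢ : ∀ {n} (v : Fin (suc n)) {i j} → i ≢ j → punchIn v i ≢ punchIn v j
punchIn-≢ v i≢j = i≢j ∘ punchIn-injective v _ _

v≢punchIn : ∀ {n} (v : Fin (suc n)) i → v ≢ punchIn v i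
v≢punchIn v i = punchInᵢ≢i v i ∘ sym

≢-by-membership : ∀ {n} (X : Subset n) {i j} → Vec.lookup X i ≡ true → Vec.lookup X j ≡ false → i ≢ j
≢-by-membership X i∈X j∉X refl = Bool.not-¬ i∈X j∉X

cutRank-delete : ∀ {n} (G : Adj (suc n)) v A {r} → RankLe (cutMatrix (delete G v) A) r →
  RankLe (G [ extend v false A , extend v false (∁ A) ]) r
cutRank-delete G v A {r} (B , C , A≡BC) =
  RankLe-mask G _ _ (λ x → row (position v x)) (λ t y → column (position v y) t)
              (λ x y → entry (position v x) (position v y))
  where
  row : ∀ {x} → Position v x → Vector Bool r
  row at      = 0ᵥ
  row (off i) = B i
  column : ∀ {y} → Position v y → Vector Bool r
  column at      = 0ᵥ
  column (off j) = col C j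
  entry : ∀ {x y} (px : Position v x) (py : Position v y) → Vec.lookup (extend v false A) x ≡ true →
    Vec.lookup (extend v false (∁ A)) y ≡ true → G x y ≡ row px · column py
  entry at      _       v∈ _  = ⊥-elim (Bool.not-¬ v∈ (insertAt-lookup A v false))
  entry (off i) at      _  v∈ = ⊥-elim (Bool.not-¬ v∈ (insertAt-lookup (∁ A) v false))
  entry (off i) (off j) i∈ j∈ =
    trans (sym (cutMatrix-support (delete G v) A (extend-∈ v i∈) (extend-∁-∈ v j∈))) (A≡BC i j)

-- One extra coordinate, carrying the row of w in G, turns a factorisation of the cut matrix of Z in
-- (G × vw) − v into one of G[Z ∪ v, (V ∖ Z) ∪ v]; see entry-via-pivot.
module PivotCut {n} {G : Adj (suc n)} (simple : IsSimple G) (v : Fin (suc n)) {w′ : Fin n}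
  (vw : G v (punchIn v w′) ≡ true) (Z : Subset n) (w′∉Z : Vec.lookup Z w′ ≡ false) {r}
  (B : Matrix n r) (C : Matrix r n)
  (H≡BC : ∀ i j → cutMatrix (delete (pivot G v (punchIn v w′)) v) Z i j ≡ B i · col C j) where

  open ≡-Reasoning

  private
    symmetric = proj₁ simple
    w = punchIn v w′

    B·C≡pivot : ∀ {i j} → Vec.lookup Z i ≡ true → Vec.lookup Z j ≡ false →
      B i · col C j ≡ pivot G v w (punchIn v i) (punchIn v j)
    B·C≡pivot {i} {j} i∈Z j∉Z = trans (sym (H≡BC i j)) (cutMatrix-support (delete (pivot G v w) v) Z i∈Z j∉Z)

    B·C≡G : ∀ {i} → Vec.lookup Z i ≡ true → B i · col C w′ ≡ G v (punchIn v i)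
    B·C≡G {i} i∈Z = trans (B·C≡pivot i∈Z w′∉Z)
      (pivot-column simple vw (punchIn-≢ v (≢-by-membership Z i∈Z w′∉Z)) (v≢punchIn v i))

  row : ∀ {x} → Position v x → Vector Bool (suc r)
  row at      = unitVector zero
  row (off i) = G w (punchIn v i) ∷ B i

  columnOff : ∀ j → Dec (j ≡ w′) → Vector Bool (suc r)
  columnOff j (yes _) = unitVector zero
  columnOff j (no _)  = G v (punchIn v j) ∷ zipWith _xor_ (col C j) (map (G w (punchIn v j) ∧_) (col C w′))

  column : ∀ {y} → Position v y → Vector Bool (suc r)
  column at      = false ∷ col C w′
  column (off j) = columnOff j (j ≟ w′)

  entry-off-off : ∀ {i} → Vec.lookup Z i ≡ true → ∀ j (j≟w′ : Dec (j ≡ w′)) → Vec.lookup Z j ≡ false →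
    G (punchIn v i) (punchIn v j) ≡ row (off i) · columnOff j j≟w′
  entry-off-off {i} i∈Z j (yes refl) _ = sym (begin
    (G w x ∧ true) xor B i · 0ᵥ ≡⟨ cong₂ _xor_ (∧-identityʳ (G w x)) (·-zeroʳ (B i)) ⟩
    G w x xor false             ≡⟨ xor-identityʳ (G w x) ⟩
    G w x                       ≡⟨ symmetric w x ⟩
    G x w                       ∎)
    where x = punchIn v i
  entry-off-off {i} i∈Z j (no j≢w′) j∉Z = begin
    G x y
      ≡⟨ entry-via-pivot simple vw (punchIn-≢ v (≢-by-membership Z i∈Z j∉Z)) (v≢punchIn v i) (v≢punchIn v j)
                         (punchIn-≢ v (≢-by-membership Z i∈Z w′∉Z ∘ sym)) (punchIn-≢ v (j≢w′ ∘ sym)) ⟩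
    (G w x ∧ G v y) xor (pivot G v w x y xor (G w y ∧ pivot G v w x w))
      ≡⟨ cong₂ (λ a b → (G w x ∧ G v y) xor (a xor (G w y ∧ b))) (B·C≡pivot i∈Z j∉Z) (B·C≡pivot i∈Z w′∉Z) ⟨
    (G w x ∧ G v y) xor (B i · col C j xor (G w y ∧ B i · col C w′))
      ≡⟨ cong (λ b → (G w x ∧ G v y) xor (B i · col C j xor b)) (·-scaleʳ (G w y) (B i) (col C w′)) ⟨
    (G w x ∧ G v y) xor (B i · col C j xor B i · map (G w y ∧_) (col C w′))
      ≡⟨ cong ((G w x ∧ G v y) xor_) (·-distribˡ-xor (B i) (col C j) _) ⟨
    row (off i) · columnOff j (no j≢w′) ∎
    where
    x = punchIn v i
    y = punchIn v j

  entry : ∀ {x y} (px : Position v x) (py : Position v y) → Vec.lookup (extend v true Z) x ≡ true →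
    Vec.lookup (extend v true (∁ Z)) y ≡ true → G x y ≡ row px · column py
  entry at at _ _ = trans (proj₂ simple v) (sym (unitVector-· zero (column at)))
  entry at (off j) _ _ = trans (entry-v (j ≟ w′)) (sym (unitVector-· zero (columnOff j (j ≟ w′))))
    where
    entry-v : (j≟w′ : Dec (j ≡ w′)) → G v (punchIn v j) ≡ columnOff j j≟w′ zero
    entry-v (yes refl) = vw
    entry-v (no _)     = refl
  entry (off i) at i∈ _ = sym (begin
    (G w x ∧ false) xor B i · col C w′ ≡⟨ cong (_xor B i · col C w′) (∧-zeroʳ (G w x)) ⟩
    B i · col C w′                    ≡⟨ B·C≡G (extend-∈ v i∈) ⟩
    G v x                             ≡⟨ symmetric v x ⟩
    G x v                             ∎)
    where x = punchIn v i
  entry (off i) (off j) i∈ j∈ = entry-off-off (extend-∈ v i∈) j (j ≟ w′) (extend-∁-∈ v j∈)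

module _ {n} {G : Adj (suc n)} (simple : IsSimple G) (v : Fin (suc n)) where

  cutRank-pivot-delete : ∀ {w′} → G v (punchIn v w′) ≡ true → ∀ Z {r} → Vec.lookup Z w′ ≡ false →
    RankLe (cutMatrix (delete (pivot G v (punchIn v w′)) v) Z) r →
    RankLe (G [ extend v true Z , extend v true (∁ Z) ]) (suc r)
  cutRank-pivot-delete vw Z w′∉Z (B , C , H≡BC) =
    RankLe-mask G _ _ (λ x → row (position v x)) (λ t y → column (position v y) t)
                (λ x y → entry (position v x) (position v y))
    where open PivotCut simple v vw Z w′∉Z B C H≡BC

  uncross : ∀ A Y {r s} → RankLe (G [ extend v false A , extend v false (∁ A) ]) r →
    RankLe (G [ extend v true Y , extend v true (∁ Y) ]) s →
    ∃₂ λ c d → c + d ≤ r + s × RankLe (cutMatrix G (extend v false (A ∩ Y))) c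
                             × RankLe (cutMatrix G (extend v false (∁ A ∩ ∁ Y))) d
  uncross A Y h₁ h₂
    with submatrix-submodular G (extend v false A) (extend v false (∁ A))
                                (extend v true Y) (extend v true (∁ Y)) h₁ h₂
  ... | c , d , c+d≤r+s , meet , join =
    c , d , c+d≤r+s ,
    RankLe-cut G (extend v false (A ∩ Y))
      (subst₂ (λ S T → RankLe (G [ S , T ]) c) (extend-∩ v false true A Y) meetColumns meet) ,
    RankLe-cut G (extend v false (∁ A ∩ ∁ Y))
      (submatrix-transpose simple (∁ (extend v false (∁ A ∩ ∁ Y))) (extend v false (∁ A ∩ ∁ Y))
      (subst₂ (λ S T → RankLe (G [ S , T ]) d) joinRows (extend-∩ v false true (∁ A) (∁ Y)) join))
    where
    open ≡-Reasoning
    meetColumns : extend v false (∁ A) ∪ extend v true (∁ Y) ≡ ∁ (extend v false (A ∩ Y))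
    meetColumns = begin
      extend v false (∁ A) ∪ extend v true (∁ Y) ≡⟨ extend-∪ v false true (∁ A) (∁ Y) ⟩
      extend v true (∁ A ∪ ∁ Y)                  ≡⟨ cong (extend v true) (deMorgan₁ A Y) ⟨
      extend v true (∁ (A ∩ Y))                  ≡⟨ ∁-extend v false (A ∩ Y) ⟨
      ∁ (extend v false (A ∩ Y))                 ∎
    joinRows : extend v false A ∪ extend v true Y ≡ ∁ (extend v false (∁ A ∩ ∁ Y))
    joinRows = begin
      extend v false A ∪ extend v true Y     ≡⟨ extend-∪ v false true A Y ⟩
      extend v true (A ∪ Y)                  ≡⟨ cong (extend v true) (cong₂ _∪_ (∁-involutive A) (∁-involutive Y)) ⟨
      extend v true (∁ (∁ A) ∪ ∁ (∁ Y))      ≡⟨ cong (extend v true) (deMorgan₁ (∁ A) (∁ Y)) ⟨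
      extend v true (∁ (∁ A ∩ ∁ Y))          ≡⟨ ∁-extend v false (∁ A ∩ ∁ Y) ⟨
      ∁ (extend v false (∁ A ∩ ∁ Y))         ∎

module Separations {n} (G : Adj (suc n)) (v : Fin (suc n)) where

  Small : ℕ → Subset n → Set
  Small k Q = CutRankLt G (extend v false Q) k

  Coverable : ℕ → Subset n → Set
  Coverable k S = ∃₂ λ Q Q′ → Q ⊆ S × Q′ ⊆ S × S ⊆ Q ∪ Q′ × Small k Q × Small k Q′

  Distinguishing : Adj n → ℕ → Subset n → Set
  Distinguishing H k A = CutRankLt H A k × CutRankLt H (∁ A) k × ¬ Coverable k A × ¬ Coverable k (∁ A)

  open IsTangle

  module _ {H k 𝒯} (𝒯-tangle : IsTangle G k 𝒯) {T₁ T₂ : Family n}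
           (T₁-tangle : IsTangle H k T₁) (induces₁ : Induces G v k T₁ 𝒯) (induces₂ : Induces G v k T₂ 𝒯) where

    small-subset-in-tangle : ∀ {S Q} → T₁ S ≡ true → Q ⊆ S → Small k Q → T₂ Q ≡ true
    small-subset-in-tangle {S} {Q} S∈T₁ Q⊆S Q-small with 𝒯 (extend v false Q) in Q∈?𝒯
    ... | true  = subst (λ X → T₂ X ≡ true) (restrict-extend v false Q) (proj₂ (proj₁ (induces₂ _) Q∈?𝒯))
    ... | false = ⊥-elim (noTriple T₁-tangle S (∁ Q) (∁ Q) S∈T₁ ∁Q∈T₁ ∁Q∈T₁
                            (∪-≡⊤ (p⊆p∪q (∁ Q) ∘ p⊆q⇒∁p⊇∁q Q⊆S)))
      where
      ∁Q∈T₁ : T₁ (∁ Q) ≡ true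
      ∁Q∈T₁ = subst (λ X → T₁ X ≡ true) (trans (restrict-∁ v (extend v false Q)) (cong ∁ (restrict-extend v false Q)))
                (proj₂ (proj₁ (induces₁ (∁ (extend v false Q)))
                  (trans (exactlyOne 𝒯-tangle _ Q-small) (cong not Q∈?𝒯))))

    uncoverable : IsTangle H k T₂ → ∀ {S} → T₁ S ≡ true → T₂ (∁ S) ≡ true → ¬ Coverable k S
    uncoverable T₂-tangle {S} S∈T₁ ∁S∈T₂ (Q , Q′ , Q⊆S , Q′⊆S , S⊆Q∪Q′ , Q-small , Q′-small) =
      noTriple T₂-tangle (∁ S) Q Q′ ∁S∈T₂
        (small-subset-in-tangle S∈T₁ Q⊆S Q-small) (small-subset-in-tangle S∈T₁ Q′⊆S Q′-small)
        (∪-≡⊤ (subst (_⊆ Q ∪ Q′) (sym (∁-involutive S)) S⊆Q∪Q′))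

  distinguishing : ∀ {H k 𝒯 T₁ T₂} → IsTangle G k 𝒯 → IsTangle H k T₁ → IsTangle H k T₂ →
    Induces G v k T₁ 𝒯 → Induces G v k T₂ 𝒯 → ∀ {A} → T₁ A ≡ true → T₂ A ≡ false → Distinguishing H k A
  distinguishing {T₁ = T₁} t t₁ t₂ i₁ i₂ {A} A∈T₁ A∉T₂ =
    inSk t₁ A A∈T₁ , inSk t₂ (∁ A) ∁A∈T₂ ,
    uncoverable t t₁ i₁ i₂ t₂ A∈T₁ ∁A∈T₂ ,
    uncoverable t t₂ i₂ i₁ t₁ ∁A∈T₂ (subst (λ X → T₁ X ≡ true) (sym (∁-involutive A)) A∈T₁)
    where
    ∁A∈T₂ = trans (exactlyOne t₂ A (inSk t₁ A A∈T₁)) (cong not A∉T₂)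

  distinguishing-of-split : ∀ {H k 𝒯} → IsTangle G k 𝒯 → Splits G v H k 𝒯 → ∃ (Distinguishing H k)
  distinguishing-of-split t (T₁ , T₂ , t₁ , t₂ , T₁≢T₂ , i₁ , i₂)
    with anySubset? (λ A → ¬? (T₁ A Bool.≟ T₂ A))
  ... | no ∄disagreement = ⊥-elim (T₁≢T₂ λ A → decidable-stable (T₁ A Bool.≟ T₂ A) (λ ≢ → ∄disagreement (A , ≢)))
  ... | yes (A , T₁A≢T₂A) with T₁ A in A?T₁ | T₂ A in A?T₂
  ...   | true  | false = A , distinguishing t t₁ t₂ i₁ i₂ A?T₁ A?T₂
  ...   | false | true  = A , distinguishing t t₂ t₁ i₂ i₁ A?T₂ A?T₁
  ...   | true  | true  = ⊥-elim (T₁A≢T₂A refl)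
  ...   | false | false = ⊥-elim (T₁A≢T₂A refl)

  distinguishing-order : ∀ {H k A} → Distinguishing H k A → k < suc (suc n)
  distinguishing-order {k = k} {A} (_ , _ , A-uncoverable , _) with k <? suc (suc n)
  ... | yes k<n+2 = k<n+2
  ... | no k≮n+2  = ⊥-elim (A-uncoverable (A , A , ⊆-refl , ⊆-refl , p⊆p∪q A , A-small , A-small))
    where
    A-small : Small k A
    A-small = suc n , ≮⇒≥ k≮n+2 , RankLe-rows _

  Coverable? : ∀ k S → Dec (Coverable k S)
  Coverable? k S = anySubset? λ Q → anySubset? λ Q′ →
    Q ⊆? S ×-dec Q′ ⊆? S ×-dec S ⊆? Q ∪ Q′ ×-dec Small? Q ×-dec Small? Q′
    where
    Small? : ∀ Q → Dec (Small k Q)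
    Small? Q = CutRankLt? G (extend v false Q) k

  Distinguishing? : ∀ H k A → Dec (Distinguishing H k A)
  Distinguishing? H k A = CutRankLt? H A k ×-dec CutRankLt? H (∁ A) k ×-dec
                          ¬? (Coverable? k A) ×-dec ¬? (Coverable? k (∁ A))

  covered-by : ∀ {k S Q Q′} → Q ⊆ S → Q′ ⊆ S → S ⊆ Q ∪ Q′ → ¬ Coverable k S → ¬ (Small k Q × Small k Q′)
  covered-by Q⊆S Q′⊆S S⊆Q∪Q′ S-uncoverable (Q-small , Q′-small) =
    S-uncoverable (_ , _ , Q⊆S , Q′⊆S , S⊆Q∪Q′ , Q-small , Q′-small)

sum-split : ∀ {a b c d k k′} → c + d ≤ a + suc b → a < k → b < k′ → c < k ⊎ d < k′
sum-split {c = c} {d} {k} {k′} c+d≤a+b+1 a<k b<k′ with c <? k | d <? k′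
... | yes c<k | _        = inj₁ c<k
... | no _    | yes d<k′ = inj₂ d<k′
... | no c≮k  | no d≮k′  =
  ⊥-elim (<-irrefl refl (≤-trans (+-mono-≤ a<k b<k′) (≤-trans (+-mono-≤ (≮⇒≥ c≮k) (≮⇒≥ d≮k′)) c+d≤a+b+1)))

+-suc-comm : ∀ a b → a + suc b ≡ b + suc a
+-suc-comm a b = trans (+-suc a b) (trans (cong suc (+-comm a b)) (sym (+-suc b a)))

quadrant-contradiction : ∀ {k k′ : ℕ} (q₁ q₂ q₃ q₄ : ℕ → Set) → (q₁ k → q₁ k′) → (q₂ k → q₂ k′) →
  q₁ k ⊎ q₄ k′ → q₁ k′ ⊎ q₄ k → q₂ k ⊎ q₃ k′ → q₂ k′ ⊎ q₃ k →
  ¬ (q₁ k × q₂ k) → ¬ (q₃ k × q₄ k) → ¬ (q₁ k′ × q₃ k′) → ¬ (q₂ k′ × q₄ k′) → ⊥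
quadrant-contradiction q₁ q₂ q₃ q₄ mono₁ mono₂ F₁ F₂ F₃ F₄ N₁ N₂ N₃ N₄ =
  Sum.[ (λ q₂k → N₄ (mono₂ q₂k , q₄k′)) , (λ q₃k′ → N₃ (q₁k′ , q₃k′)) ] F₃
  where
  ¬q₁k : ¬ q₁ _
  ¬q₁k q₁k = Sum.[ (λ q₂k → N₁ (q₁k , q₂k)) , (λ q₃k′ → N₃ (mono₁ q₁k , q₃k′)) ] F₃
  q₄k′ = Sum.[ ⊥-elim ∘ ¬q₁k , (λ q₄k′ → q₄k′) ] F₁
  ¬q₄k : ¬ q₄ _
  ¬q₄k q₄k = Sum.[ (λ q₂k′ → N₄ (q₂k′ , q₄k′)) , (λ q₃k → N₂ (q₃k , q₄k)) ] F₄
  q₁k′ = Sum.[ (λ q₁k′ → q₁k′) , ⊥-elim ∘ ¬q₄k ] F₂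

module _ {n} {G : Adj (suc n)} (simple : IsSimple G) (v : Fin (suc n)) {w′ : Fin n}
         (vw : G v (punchIn v w′) ≡ true) where

  open Separations G v

  private
    H₁ H₂ : Adj n
    H₁ = delete G v
    H₂ = delete (pivot G v (punchIn v w′)) v

  cutRank-pivot-bound : ∀ B {k} → CutRankLt H₂ B k → CutRankLt H₂ (∁ B) k →
    ∃ λ r → r < k × RankLe (G [ extend v true B , extend v true (∁ B) ]) (suc r)
  cutRank-pivot-bound B (r , r<k , B-rank) (r′ , r′<k , ∁B-rank) with Vec.lookup B w′ in w′∈?B
  ... | false = r , r<k , cutRank-pivot-delete simple v vw B w′∈?B B-rank
  ... | true  = r′ , r′<k ,
    subst (λ X → RankLe (G [ extend v true X , extend v true (∁ B) ]) (suc r′)) (∁-involutive B)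
      (submatrix-transpose simple (extend v true (∁ B)) (extend v true (∁ (∁ B)))
        (cutRank-pivot-delete simple v vw (∁ B) w′∉∁B ∁B-rank))
    where
    w′∉∁B = trans (lookup-map w′ not B) (cong not w′∈?B)

  small-quadrants : ∀ A Y {k k′} → CutRankLt H₁ A k →
    (∃ λ s → s < k′ × RankLe (G [ extend v true Y , extend v true (∁ Y) ]) (suc s)) →
    (Small k (A ∩ Y) ⊎ Small k′ (∁ A ∩ ∁ Y)) × (Small k′ (A ∩ Y) ⊎ Small k (∁ A ∩ ∁ Y))
  small-quadrants A Y (r , r<k , A-rank) (s , s<k′ , Y-rank)
    with uncross simple v A Y (cutRank-delete G v A A-rank) Y-rank
  ... | c , d , c+d≤ , meet , join =
    Sum.map (λ c<k → c , c<k , meet) (λ d<k′ → d , d<k′ , join) (sum-split c+d≤ r<k s<k′) ,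
    Sum.map (λ c<k′ → c , c<k′ , meet) (λ d<k → d , d<k , join)
            (sum-split (subst (c + d ≤_) (+-suc-comm r s) c+d≤) s<k′ r<k)

  no-two-distinguishers : ∀ {k k′ A B} → Distinguishing H₁ k A → Distinguishing H₂ k′ B → ⊥
  no-two-distinguishers {k} {k′} {A} {B} (A-rank , _ , A-unc , ∁A-unc) (B-rank , ∁B-rank , B-unc , ∁B-unc) =
    Sum.[ (λ k≤k′ → quadrant-contradiction q₁ q₂ q₃ q₄ (mono k≤k′) (mono k≤k′) F₁ F₂ F₃ F₄ N₁ N₂ N₃ N₄)
        , (λ k′≤k → quadrant-contradiction q₁ q₃ q₂ q₄ (mono k′≤k) (mono k′≤k)
                      F₂ F₁ (Sum.swap F₃) (Sum.swap F₄) N₃ N₄ N₁ N₂)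
        ] (≤-total k k′)
    where
    q₁ q₂ q₃ q₄ : ℕ → Set
    q₁ j = Small j (A ∩ B)
    q₂ j = Small j (A ∩ ∁ B)
    q₃ j = Small j (∁ A ∩ B)
    q₄ j = Small j (∁ A ∩ ∁ B)
    mono : ∀ {j j′ Q} → j ≤ j′ → Small j Q → Small j′ Q
    mono j≤j′ (r , r<j , rank) = r , ≤-trans r<j j≤j′ , rank
    N₁ = covered-by (p∩q⊆p A B) (p∩q⊆p A (∁ B)) (⊆-∩-split A B) A-unc
    N₂ = covered-by (p∩q⊆p (∁ A) B) (p∩q⊆p (∁ A) (∁ B)) (⊆-∩-split (∁ A) B) ∁A-unc
    N₃ = covered-by (p∩q⊆q A B) (p∩q⊆q (∁ A) B) (⊆-∩-splitʳ B A) B-unc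
    N₄ = covered-by (p∩q⊆q A (∁ B)) (p∩q⊆q (∁ A) (∁ B)) (⊆-∩-splitʳ (∁ B) A) ∁B-unc
    F₁₂ = small-quadrants A B A-rank (cutRank-pivot-bound B B-rank ∁B-rank)
    F₁ = proj₁ F₁₂
    F₂ = proj₂ F₁₂
    F₃₄ = subst (λ X → (q₂ k ⊎ Small k′ (∁ A ∩ X)) × (q₂ k′ ⊎ Small k (∁ A ∩ X))) (∁-involutive B)
            (small-quadrants A (∁ B) A-rank
              (cutRank-pivot-bound (∁ B) ∁B-rank (subst (λ X → CutRankLt H₂ X k′) (sym (∁-involutive B)) B-rank)))
    F₃ = proj₁ F₃₄
    F₄ = proj₂ F₃₄

  noSplit-delete-or-pivot : NoSplit G v H₁ ⊎ NoSplit G v H₂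
  noSplit-delete-or-pivot with anyUpTo? (λ k → anySubset? (Distinguishing? H₁ k)) (suc (suc n))
  ... | yes (k , _ , A , A-dist) =
    inj₂ λ _ _ _ t split → no-two-distinguishers A-dist (proj₂ (distinguishing-of-split t split))
  ... | no none =
    inj₁ λ k _ _ t split → let (A , A-dist) = distinguishing-of-split t split in
                           none (k , distinguishing-order A-dist , A , A-dist)

theorem4p3 : ∀ (n : ℕ) (G : Adj (suc n)) → IsSimple G → (v w : Fin (suc n)) → G v w ≡ true →
    NoSplit G v (delete G v) ⊎ NoSplit G v (delete (pivot G v w) v)
theorem4p3 n G simple v w vw with position v w
... | at     = ⊥-elim (Bool.not-¬ vw (proj₂ simple v))
... | off w′ = noSplit-delete-or-pivot simple v vw
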